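{- Let $\varphi$ be an IPDL-formula all of whose propositional variables are among $p_1,\ldots,p_n$ and all of whose atomic program terms are among $a_1,\ldots,a_l$ (with $l\geq 1$). Let $\gamma = a_1\cup\cdots\cup a_l$. Define the translation $\cdot'$ recursively by: $a_j' = a_j$; $(\alpha;\beta)' = \alpha';\beta'$; $(\alpha\cup\beta)'=\alpha'\cup\beta'$; $(\alpha\cap\beta)'=\alpha'\cap\beta'$; $(\alpha^*)'=(\alpha')^*$; $(\phi?)'=(\phi')?$; $p_i'=p_i$; $\bot'=\bot$; $(\phi\to\psi)'=\phi'\to\psi'$; $([\alpha]\phi)' = [\alpha'](p_{n+1}\to\phi')$. Let $\Theta = p_{n+1}\wedge[\gamma^*](\langle\gamma\rangle p_{n+1}\to p_{n+1})$ and $\widehat{\varphi} = \Theta\wedge\varphi'$. Then $\varphi$ is satisfiable if and only if $\widehat{\varphi}$ is satisfiable.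
   Context: IPDL (PDL with intersection): formulas and program terms are defined simultaneously by $\varphi ::= p \mid \bot \mid (\varphi\to\varphi)\mid [\alpha]\varphi$ and $\alpha ::= a \mid \varphi? \mid (\alpha;\alpha)\mid(\alpha\cup\alpha)\mid(\alpha\cap\alpha)\mid\alpha^*$, where $p$ ranges over a countable set of propositional variables $p_1,p_2,\ldots$ and $a$ over a countable set of atomic program terms $a_1,a_2,\ldots$. Abbreviations: $\neg\varphi = \varphi\to\bot$, $\top=\neg\bot$, $\wedge,\vee,\leftrightarrow$ as usual, $\langle\alpha\rangle\varphi = \neg[\alpha]\neg\varphi$. A Kripke model is $\mathfrak{M}=(S,\{R_a\}_a,V)$ with $S$ nonempty, each $R_a\subseteq S\times S$, and $V$ mapping variables to subsets of $S$. Relations for compound programs and truth are defined by simultaneous induction: $R_{\varphi?}=\{(s,s): \mathfrak{M},s\models\varphi\}$; $R_{\alpha;\beta}$ is the relational composition; $R_{\alpha\cup\beta}=R_\alpha\cup R_\beta$; $R_{\alpha\cap\beta}=R_\alpha\cap R_\beta$; $R_{\alpha^*}$ is the reflexive transitive closure of $R_\alpha$; $\mathfrak{M},s\models p$ iff $s\in V(p)$; $\bot$ is never true; $\to$ is classical; $\mathfrak{M},s\models[\alpha]\varphi$ iff $\mathfrak{M},t\models\varphi$ for all $t$ with $(s,t)\in R_\alpha$. A formula is satisfiable if it is true at some state of some model. -}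

module Defs where

open import Data.Nat using (ℕ; zero; suc; _≤_)
open import Data.Product using (Σ; _×_; _,_; ∃)
open import Data.Sum using (_⊎_)
open import Data.Empty using (⊥)
open import Data.Unit using (⊤)
open import Relation.Binary.PropositionalEquality using (_≡_)
open import Relation.Binary.Construct.Closure.ReflexiveTransitive using (Star)

-- Propositional variables p_i are  var i ; atomic programs a_j are  atom j
-- (indices are natural numbers; the paper's p_1, p_2, … are var 1, var 2, …).
infixr 5 _⇒_
mutual
  data Form : Set where
    var  : ℕ → Form
    bot  : Form
    _⇒_  : Form → Form → Form
    box  : Prog → Form → Form

  data Prog : Set where
    atom : ℕ → Prog
    test : Form → Prog
    _⨾_  : Prog → Prog → Prog
    _∪ₚ_ : Prog → Prog → Prog
    _∩ₚ_ : Prog → Prog → Prog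
    star : Prog → Prog

neg : Form → Form
neg φ = φ ⇒ bot

top : Form
top = neg bot

_∧ᶠ_ : Form → Form → Form
φ ∧ᶠ ψ = neg (φ ⇒ neg ψ)

dia : Prog → Form → Form
dia α φ = neg (box α (neg φ))

record Model : Set₁ where
  field
    S   : Set
    R   : ℕ → S → S → Set
    V   : ℕ → S → Set

open Model public

mutual
  Rel : (M : Model) → Prog → S M → S M → Set
  Rel M (atom j)  s t = R M j s t
  Rel M (test φ)  s t = (s ≡ t) × (M ▸ s ⊨ φ)
  Rel M (α ⨾ β)   s t = Σ (S M) λ u → Rel M α s u × Rel M β u t
  Rel M (α ∪ₚ β)  s t = Rel M α s t ⊎ Rel M β s t
  Rel M (α ∩ₚ β)  s t = Rel M α s t × Rel M β s t
  Rel M (star α)  s t = Star (Rel M α) s t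

  _▸_⊨_ : (M : Model) → S M → Form → Set
  M ▸ s ⊨ var i   = V M i s
  M ▸ s ⊨ bot     = ⊥
  M ▸ s ⊨ (φ ⇒ ψ) = M ▸ s ⊨ φ → M ▸ s ⊨ ψ
  M ▸ s ⊨ box α φ = ∀ t → Rel M α s t → M ▸ t ⊨ φ
  infix 4 _▸_⊨_

Satisfiable : Form → Set₁
Satisfiable φ = Σ Model λ M → Σ (S M) λ s → M ▸ s ⊨ φ

mutual
  VarsAmong : ℕ → Form → Set
  VarsAmong n (var i)   = (1 ≤ i) × (i ≤ n)
  VarsAmong n bot       = ⊤
  VarsAmong n (φ ⇒ ψ)   = VarsAmong n φ × VarsAmong n ψ
  VarsAmong n (box α φ) = VarsAmongP n α × VarsAmong n φ

  VarsAmongP : ℕ → Prog → Set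
  VarsAmongP n (atom j)  = ⊤
  VarsAmongP n (test φ)  = VarsAmong n φ
  VarsAmongP n (α ⨾ β)   = VarsAmongP n α × VarsAmongP n β
  VarsAmongP n (α ∪ₚ β)  = VarsAmongP n α × VarsAmongP n β
  VarsAmongP n (α ∩ₚ β)  = VarsAmongP n α × VarsAmongP n β
  VarsAmongP n (star α)  = VarsAmongP n α

mutual
  AtomsAmong : ℕ → Form → Set
  AtomsAmong l (var i)   = ⊤
  AtomsAmong l bot       = ⊤
  AtomsAmong l (φ ⇒ ψ)   = AtomsAmong l φ × AtomsAmong l ψ
  AtomsAmong l (box α φ) = AtomsAmongP l α × AtomsAmong l φ

  AtomsAmongP : ℕ → Prog → Set
  AtomsAmongP l (atom j)  = (1 ≤ j) × (j ≤ l)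
  AtomsAmongP l (test φ)  = AtomsAmong l φ
  AtomsAmongP l (α ⨾ β)   = AtomsAmongP l α × AtomsAmongP l β
  AtomsAmongP l (α ∪ₚ β)  = AtomsAmongP l α × AtomsAmongP l β
  AtomsAmongP l (α ∩ₚ β)  = AtomsAmongP l α × AtomsAmongP l β
  AtomsAmongP l (star α)  = AtomsAmongP l α

-- γ = a_1 ∪ ⋯ ∪ a_l  (left-associated; only used for l ≥ 1, the l = 0 case is a dummy)
gamma : ℕ → Prog
gamma zero          = atom 1
gamma (suc zero)    = atom 1
gamma (suc (suc m)) = gamma (suc m) ∪ₚ atom (suc (suc m))

mutual
  tr : ℕ → Form → Form
  tr n (var i)   = var i
  tr n bot       = bot
  tr n (φ ⇒ ψ)   = tr n φ ⇒ tr n ψ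
  tr n (box α φ) = box (trP n α) (var (suc n) ⇒ tr n φ)

  trP : ℕ → Prog → Prog
  trP n (atom j)  = atom j
  trP n (test φ)  = test (tr n φ)
  trP n (α ⨾ β)   = trP n α ⨾ trP n β
  trP n (α ∪ₚ β)  = trP n α ∪ₚ trP n β
  trP n (α ∩ₚ β)  = trP n α ∩ₚ trP n β
  trP n (star α)  = star (trP n α)

Theta : ℕ → ℕ → Form
Theta n l = var (suc n) ∧ᶠ box (star (gamma l)) (dia (gamma l) (var (suc n)) ⇒ var (suc n))

hat : ℕ → ℕ → Form → Form
hat n l φ = Theta n l ∧ᶠ tr n φ

module Submission where

-- (⇒) Make every variable beyond p_n true everywhere.  The guards of φ' then
--     become vacuous, so φ' holds wherever φ held, and Θ holds trivially.
-- (⇐) Given M, s ⊨ Θ ∧ φ', call a state good when it is γ*-reachable from s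
--     and satisfies p_{n+1}, and restrict every atomic relation to good states.
--     Programs over a_1, …, a_l preserve every predicate their atoms preserve;
--     so they stay in the reachable part and, by the contrapositive of Θ, also
--     preserve ¬p_{n+1} there, i.e. p_{n+1} propagates backwards along them.
--     Consequently, between good states a program holds in the restriction iff
--     its translation holds in M, and at good states φ holds in the restriction
--     iff φ' holds in M; apply this at s.
-- Excluded middle (an assumption of the theorem) is used to decompose the
-- defined conjunction ¬(φ → ¬ψ) and to decide p_{n+1} at intermediate states.

open import Defs
open import Data.Nat using (ℕ; _≤_)
open import Function.Bundles using (_⇔_)
open import Axiom.ExcludedMiddle using (ExcludedMiddle)
open import Level using (0ℓ)

open import Data.Nat using (zero; suc; _<_; s≤s)
open import Data.Nat.Properties using (<⇒≱; ≤-pred; m≤n⇒m<n∨m≡n; n<1+n)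
open import Data.Product using (_×_; _,_; proj₁; proj₂)
open import Data.Product.Function.NonDependent.Propositional using (_×-⇔_)
open import Data.Sum using (_⊎_; inj₁; inj₂; [_,_])
open import Data.Sum.Function.Propositional using (_⊎-⇔_)
open import Data.Empty using (⊥-elim)
open import Function using (id; _∘_)
open import Function.Bundles using (mk⇔; Equivalence)
open import Function.Construct.Identity using (⇔-id)
open import Function.Related.TypeIsomorphisms using (→-cong-⇔)
open import Relation.Nullary using (¬_)
open import Relation.Nullary.Decidable using (decidable-stable)
open import Relation.Binary.PropositionalEquality using (refl)
open import Relation.Binary.Construct.Closure.ReflexiveTransitive as Star
  using (Star; ε; _◅_; _◅◅_)

open Equivalence using (to; from)

classical-∧ : ExcludedMiddle 0ℓ → {A B : Set} → ¬ (A → ¬ B) → A × B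
classical-∧ em h = decidable-stable em (λ ¬a → h (λ a _ → ¬a a))
                 , decidable-stable em (λ ¬b → h (λ _ b → ¬b b))

atom⊆gamma : (M : Model) (l j : ℕ) → 1 ≤ j → j ≤ l →
             ∀ {t u} → R M j t u → Rel M (gamma l) t u
atom⊆gamma M (suc zero)    (suc zero)    _   _        r = r
atom⊆gamma M (suc zero)    (suc (suc _)) _   (s≤s ()) r
atom⊆gamma M (suc (suc m)) j 1≤j j≤l r =
  [ (λ j<l → inj₁ (atom⊆gamma M (suc m) j 1≤j (≤-pred j<l) r))
  , (λ { refl → inj₂ r })
  ] (m≤n⇒m<n∨m≡n j≤l)

Invariant : (M : Model) → (S M → Set) → Prog → Set
Invariant M P α = ∀ {t u} → Rel M α t u → P t → P u

invariant : (M : Model) (P : S M → Set) {l : ℕ} →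
            (∀ {j} → 1 ≤ j → j ≤ l → Invariant M P (atom j)) →
            ∀ α → AtomsAmongP l α → Invariant M P α
invariant M P inv (atom j) (1≤j , j≤l)  = inv 1≤j j≤l
invariant M P inv (test φ) _            (refl , _) = id
invariant M P inv (α ⨾ β)  (a , b)      (_ , r₁ , r₂) =
  invariant M P inv β b r₂ ∘ invariant M P inv α a r₁
invariant M P inv (α ∪ₚ β) (a , b)      (inj₁ r) = invariant M P inv α a r
invariant M P inv (α ∪ₚ β) (a , b)      (inj₂ r) = invariant M P inv β b r
invariant M P inv (α ∩ₚ β) (a , _)      (r , _)  = invariant M P inv α a r
invariant M P inv (star α) a =
  Star.fold (λ t u → P t → P u) (λ r k → k ∘ invariant M P inv α a r) id

mutual
  tr-atoms : ∀ n {l} φ → AtomsAmong l φ → AtomsAmong l (tr n φ)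
  tr-atoms n (var i)   _       = _
  tr-atoms n bot       _       = _
  tr-atoms n (φ ⇒ ψ)   (a , b) = tr-atoms n φ a , tr-atoms n ψ b
  tr-atoms n (box α φ) (a , b) = trP-atoms n α a , _ , tr-atoms n φ b

  trP-atoms : ∀ n {l} α → AtomsAmongP l α → AtomsAmongP l (trP n α)
  trP-atoms n (atom j)  a       = a
  trP-atoms n (test φ)  a       = tr-atoms n φ a
  trP-atoms n (α ⨾ β)   (a , b) = trP-atoms n α a , trP-atoms n β b
  trP-atoms n (α ∪ₚ β)  (a , b) = trP-atoms n α a , trP-atoms n β b
  trP-atoms n (α ∩ₚ β)  (a , b) = trP-atoms n α a , trP-atoms n β b
  trP-atoms n (star α)  a       = trP-atoms n α a

fresh-true : ℕ → Model → Model
fresh-true n M = record M { V = λ i x → n < i ⊎ V M i x }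

-- In fresh-true n M the translation of a formula over p_1, …, p_n means the
-- same as the formula in M: the variables agree and every guard p_{n+1} holds.
mutual
  ⊨-fresh-true : ∀ (M : Model) n ψ → VarsAmong n ψ →
                 ∀ {x} → (fresh-true n M ▸ x ⊨ tr n ψ) ⇔ (M ▸ x ⊨ ψ)
  ⊨-fresh-true M n (var i)   (_ , i≤n) = mk⇔ [ (λ n<i → ⊥-elim (<⇒≱ n<i i≤n)) , id ] inj₂
  ⊨-fresh-true M n bot       _         = ⇔-id _
  ⊨-fresh-true M n (φ ⇒ ψ)   (v , w)   =
    →-cong-⇔ (⊨-fresh-true M n φ v) (⊨-fresh-true M n ψ w)
  ⊨-fresh-true M n (box α ψ) (v , w)   = mk⇔
    (λ h t r → to (⊨-fresh-true M n ψ w) (h t (from (Rel-fresh-true M n α v) r) (inj₁ (n<1+n n))))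
    (λ h t r _ → from (⊨-fresh-true M n ψ w) (h t (to (Rel-fresh-true M n α v) r)))

  Rel-fresh-true : ∀ (M : Model) n α → VarsAmongP n α →
                   ∀ {x y} → Rel (fresh-true n M) (trP n α) x y ⇔ Rel M α x y
  Rel-fresh-true M n (atom j)  _       = ⇔-id _
  Rel-fresh-true M n (test φ)  v       = ⇔-id _ ×-⇔ ⊨-fresh-true M n φ v
  Rel-fresh-true M n (α ⨾ β)   (v , w) = mk⇔
    (λ (x , r₁ , r₂) → x , to (Rel-fresh-true M n α v) r₁ , to (Rel-fresh-true M n β w) r₂)
    (λ (x , r₁ , r₂) → x , from (Rel-fresh-true M n α v) r₁ , from (Rel-fresh-true M n β w) r₂)
  Rel-fresh-true M n (α ∪ₚ β)  (v , w) = Rel-fresh-true M n α v ⊎-⇔ Rel-fresh-true M n β w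
  Rel-fresh-true M n (α ∩ₚ β)  (v , w) = Rel-fresh-true M n α v ×-⇔ Rel-fresh-true M n β w
  Rel-fresh-true M n (star α)  v       = mk⇔
    (Star.map (to (Rel-fresh-true M n α v)))
    (Star.map (from (Rel-fresh-true M n α v)))

sat-forward : ∀ n l φ → VarsAmong n φ → Satisfiable φ → Satisfiable (hat n l φ)
sat-forward n l φ vφ (M , s , φ-at-s) = fresh-true n M , s , λ k → k Θ-holds φ'-holds
  where
    p-holds : ∀ {x} → fresh-true n M ▸ x ⊨ var (suc n)
    p-holds = inj₁ (n<1+n n)

    Θ-holds : fresh-true n M ▸ s ⊨ Theta n l
    Θ-holds k = k p-holds (λ _ _ _ → p-holds)

    φ'-holds : fresh-true n M ▸ s ⊨ tr n φ
    φ'-holds = from (⊨-fresh-true M n φ vφ) φ-at-s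

module Restriction (em : ExcludedMiddle 0ℓ) (M : Model) (n l : ℕ) (s : S M)
  (Θ-closed : M ▸ s ⊨ box (star (gamma l)) (dia (gamma l) (var (suc n)) ⇒ var (suc n)))
  where

  p : ℕ
  p = suc n

  Reachable : S M → Set
  Reachable = Star (Rel M (gamma l)) s

  Good : S M → Set
  Good t = Reachable t × V M p t

  restriction : Model
  restriction = record M { R = λ j t u → R M j t u × Good t × Good u }

  reachable-invariant : ∀ α → AtomsAmongP l α → Invariant M Reachable α
  reachable-invariant =
    invariant M Reachable (λ 1≤j j≤l r reach → reach ◅◅ (atom⊆gamma M l _ 1≤j j≤l r ◅ ε))

  -- Θ says ⟨γ⟩p → p on reachable states; contrapositively ¬p is invariant
  -- along γ, hence along all programs, within the reachable part.
  refuted-invariant : ∀ α → AtomsAmongP l α → Invariant M (λ t → Reachable t × ¬ V M p t) α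
  refuted-invariant = invariant M _ λ 1≤j j≤l r (reach , ¬p) →
    let step = atom⊆gamma M l _ 1≤j j≤l r
    in reach ◅◅ (step ◅ ε) , λ p-at-u → ¬p (Θ-closed _ reach (λ ¬◇p → ¬◇p _ step p-at-u))

  p-backward : ∀ α → AtomsAmongP l α → ∀ {w u} → Reachable w → Rel M α w u → V M p u → V M p w
  p-backward α a reach r p-at-u =
    decidable-stable em λ ¬p → proj₂ (refuted-invariant α a r (reach , ¬p)) p-at-u

  good-between : ∀ α β → AtomsAmongP l α → AtomsAmongP l β →
                 ∀ {t w u} → Good t → Rel M α t w → Rel M β w u → Good u → Good w
  good-between α β a b (reach , _) r₁ r₂ (_ , p-at-u) =
    let reach-w = reachable-invariant α a r₁ reach
    in reach-w , p-backward β b reach-w r₂ p-at-u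

  good-invariant : ∀ α → AtomsAmongP l α → Invariant restriction Good α
  good-invariant = invariant restriction Good λ _ _ (_ , _ , good-u) _ → good-u

  mutual
    ⊨-restriction : ∀ ψ → AtomsAmong l ψ →
                    ∀ {t} → Good t → (restriction ▸ t ⊨ ψ) ⇔ (M ▸ t ⊨ tr n ψ)
    ⊨-restriction (var i)   _       _ = ⇔-id _
    ⊨-restriction bot       _       _ = ⇔-id _
    ⊨-restriction (φ ⇒ ψ)   (a , b) g = →-cong-⇔ (⊨-restriction φ a g) (⊨-restriction ψ b g)
    ⊨-restriction (box α ψ) (a , b) g = mk⇔
      (λ h u r p-at-u →
        let good-u = reachable-invariant (trP n α) (trP-atoms n α a) r (proj₁ g) , p-at-u
        in to (⊨-restriction ψ b good-u) (h u (from (Rel-restriction α a g good-u) r)))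
      (λ h u r →
        let good-u = good-invariant α a r g
        in from (⊨-restriction ψ b good-u) (h u (to (Rel-restriction α a g good-u) r) (proj₂ good-u)))

    Rel-restriction : ∀ α → AtomsAmongP l α →
                      ∀ {t u} → Good t → Good u → Rel restriction α t u ⇔ Rel M (trP n α) t u
    Rel-restriction (atom j)  _       g good-u = mk⇔ proj₁ (λ r → r , g , good-u)
    Rel-restriction (test φ)  a       g _      = ⇔-id _ ×-⇔ ⊨-restriction φ a g
    Rel-restriction (α ⨾ β)   (a , b) g good-u = mk⇔
      (λ (w , r₁ , r₂) →
        let good-w = good-invariant α a r₁ g
        in w , to (Rel-restriction α a g good-w) r₁ , to (Rel-restriction β b good-w good-u) r₂)
      (λ (w , r₁ , r₂) →
        let good-w = good-between (trP n α) (trP n β) (trP-atoms n α a) (trP-atoms n β b)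
                                  g r₁ r₂ good-u
        in w , from (Rel-restriction α a g good-w) r₁ , from (Rel-restriction β b good-w good-u) r₂)
    Rel-restriction (α ∪ₚ β)  (a , b) g good-u =
      Rel-restriction α a g good-u ⊎-⇔ Rel-restriction β b g good-u
    Rel-restriction (α ∩ₚ β)  (a , b) g good-u =
      Rel-restriction α a g good-u ×-⇔ Rel-restriction β b g good-u
    Rel-restriction (star α)  a       g good-u = mk⇔ (star-to α a g) (star-from α a g good-u)

    star-to : ∀ α → AtomsAmongP l α →
              ∀ {t u} → Good t → Star (Rel restriction α) t u → Star (Rel M (trP n α)) t u
    star-to α a g ε        = ε
    star-to α a g (r ◅ rs) =
      let good-w = good-invariant α a r g
      in to (Rel-restriction α a g good-w) r ◅ star-to α a good-w rs

    star-from : ∀ α → AtomsAmongP l α →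
                ∀ {t u} → Good t → Good u → Star (Rel M (trP n α)) t u → Star (Rel restriction α) t u
    star-from α a g good-u ε        = ε
    star-from α a g good-u (r ◅ rs) =
      let a' = trP-atoms n α a
          good-w = good-between (trP n α) (star (trP n α)) a' a' g r rs good-u
      in from (Rel-restriction α a g good-w) r ◅ star-from α a good-w good-u rs

sat-backward : ExcludedMiddle 0ℓ → ∀ n l φ → AtomsAmong l φ →
               Satisfiable (hat n l φ) → Satisfiable φ
sat-backward em n l φ aφ (M , s , φ̂-at-s) =
  let (Θ-at-s , φ'-at-s)  = classical-∧ em φ̂-at-s
      (p-at-s , Θ-closed) = classical-∧ em Θ-at-s
      open Restriction em M n l s Θ-closed
  in restriction , s , from (⊨-restriction φ aφ (ε , p-at-s)) φ'-at-s

lemma1 : ExcludedMiddle 0ℓ → (n l : ℕ) → 1 ≤ l → (φ : Form) →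
    VarsAmong n φ → AtomsAmong l φ →
    Satisfiable φ ⇔ Satisfiable (hat n l φ)
lemma1 em n l _ φ vφ aφ = mk⇔ (sat-forward n l φ vφ) (sat-backward em n l φ aφ)
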